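{- Let $\mathcal L$ be a nominal poset which is a $\sigma$-algebra over a termlike $\sigma$-algebra $\mathsf U$ with monotone $\sigma$-action, and let $x\in\mathcal L$ and $a\in\mathbb A$. (1) If $\bigwedge^{\#a}x$ exists then so does the greatest lower bound $\bigwedge_{u\in\mathsf U}x[a:=u]$ of $\{x[a:=u]\mid u\in\mathsf U\}$, and they are equal. (2) If $\bigwedge_{u\in\mathsf U}x[a:=u]$ exists then so does $\bigwedge^{\#a}x$, and they are equal.
   Context: Atoms $\mathbb A$ (countably infinite; $a,b,c$ distinct), permutations, swappings $(a\ b)$, nominal sets, support, $a\#x$, equivariance as standard. Termlike $\sigma$-algebra $\mathsf U$: nominal set with equivariant $x[a:=u]$ and equivariant injection $\mathrm{atm}:\mathbb A\to\mathsf U$ (atom $b$ viewed in $\mathsf U$ as $\mathrm{atm}(b)$) satisfying $a[a:=x]=x$; $x[a:=a]=x$; $a\#x\Rightarrow x[a:=u]=x$; $b\#x\Rightarrow x[a:=u]=((b\ a)\cdot x)[b:=u]$; $a\#v\Rightarrow x[a:=u][b:=v]=x[b:=v][a:=u[b:=v]]$. A $\sigma$-algebra over $\mathsf U$: nominal set with equivariant substitution by elements of $\mathsf U$ satisfying the last four axioms. Nominal poset: nominal set with equivariant partial order. $\bigwedge^{\#a}x$ (the $a\#$limit of $x$) is the greatest element of $\{x'\mid x'\le x,\ a\#x'\}$, if it exists. Monotone $\sigma$-action: $x\le y$ implies $x[a:=u]\le y[a:=u]$ for all $a,u$. -}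

module Defs where

open import Data.Nat using (ℕ)
open import Data.Nat.Properties using (_≟_)
open import Data.List using (List; []; _∷_)
open import Data.List.Membership.Propositional using (_∈_; _∉_)
open import Data.List.Relation.Unary.Any using (here; there)
open import Data.Product using (Σ; ∃; _×_; _,_; proj₁; proj₂)
open import Relation.Nullary using (¬_; yes; no)
open import Relation.Nullary.Negation using (contradiction)
open import Relation.Binary.PropositionalEquality
  using (_≡_; _≢_; refl; sym; trans; cong)
open import Relation.Binary.Structures using (IsPartialOrder)

Atom : Set
Atom = ℕ

record Perm : Set where
  field
    to      : Atom → Atom
    from    : Atom → Atom
    to-from : ∀ n → to (from n) ≡ n
    from-to : ∀ n → from (to n) ≡ n
    finite  : Σ (List Atom) λ S → ∀ n → n ∉ S → to n ≡ n
open Perm public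

idP : Perm
idP = record { to = λ n → n ; from = λ n → n
             ; to-from = λ _ → refl ; from-to = λ _ → refl
             ; finite = [] , λ _ _ → refl }

_∘P_ : Perm → Perm → Perm
π ∘P τ = record
  { to = λ n → to π (to τ n)
  ; from = λ n → from τ (from π n)
  ; to-from = λ n → trans (cong (to π) (to-from τ (from π n))) (to-from π n)
  ; from-to = λ n → trans (cong (from τ) (from-to π (to τ n))) (from-to τ n)
  ; finite = (proj₁ (finite π) Data.List.++ proj₁ (finite τ)) , fin }
  where
  open import Data.List.Membership.Propositional.Properties using (∈-++⁺ˡ; ∈-++⁺ʳ)
  fin : ∀ n → n ∉ (proj₁ (finite π) Data.List.++ proj₁ (finite τ)) →
        to π (to τ n) ≡ n
  fin n n∉ with proj₂ (finite τ) n (λ i → n∉ (∈-++⁺ʳ (proj₁ (finite π)) i))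
  ... | eq rewrite eq = proj₂ (finite π) n (λ i → n∉ (∈-++⁺ˡ i))

swapA : Atom → Atom → Atom → Atom
swapA a b n with n ≟ a
... | yes _ = b
... | no _ with n ≟ b
...   | yes _ = a
...   | no _ = n

swapA-invol : ∀ a b n → swapA a b (swapA a b n) ≡ n
swapA-invol a b n with n ≟ a
swapA-invol a b n | yes n≡a with b ≟ a
... | yes b≡a = trans b≡a (sym n≡a)
... | no _ with b ≟ b
...   | yes _ = sym n≡a
...   | no b≢b = contradiction refl b≢b
swapA-invol a b n | no n≢a with n ≟ b
swapA-invol a b n | no n≢a | yes n≡b with a ≟ a
... | yes _ = sym n≡b
... | no a≢a = contradiction refl a≢a
swapA-invol a b n | no n≢a | no n≢b with n ≟ a
... | yes n≡a = contradiction n≡a n≢a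
... | no _ with n ≟ b
...   | yes n≡b = contradiction n≡b n≢b
...   | no _ = refl

swapA-fin : ∀ a b n → n ∉ (a ∷ b ∷ []) → swapA a b n ≡ n
swapA-fin a b n n∉ with n ≟ a
... | yes n≡a = contradiction (here n≡a) n∉
... | no _ with n ≟ b
...   | yes n≡b = contradiction (there (here n≡b)) n∉
...   | no _ = refl

swp : Atom → Atom → Perm
swp a b = record { to = swapA a b ; from = swapA a b
                 ; to-from = swapA-invol a b ; from-to = swapA-invol a b
                 ; finite = (a ∷ b ∷ []) , swapA-fin a b }

Supports : {X : Set} → (Perm → X → X) → List Atom → X → Set
Supports _·_ S x = ∀ (π : Perm) → (∀ a → a ∈ S → to π a ≡ a) → π · x ≡ x

record Nominal : Set₁ where
  field
    Carrier : Set
    _·_     : Perm → Carrier → Carrier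
    act-id  : ∀ x → idP · x ≡ x
    act-∘   : ∀ π τ x → π · (τ · x) ≡ (π ∘P τ) · x
    act-ext : ∀ π τ → (∀ n → to π n ≡ to τ n) → ∀ x → π · x ≡ τ · x
    finSupp : ∀ x → Σ (List Atom) λ S → Supports _·_ S x

  -- freshness: a ∉ supp(x), i.e. a lies outside some finite support of x
  -- (supp(x), the least finite support, is the intersection of all of them)
  _#_ : Atom → Carrier → Set
  a # x = Σ (List Atom) λ S → Supports _·_ S x × a ∉ S

record Termlike : Set₁ where
  field
    nom : Nominal
  open Nominal nom
  field
    _[_≔_] : Carrier → Atom → Carrier → Carrier
    atm    : Atom → Carrier
    sub-equivariant : ∀ π x a u →
      π · (x [ a ≔ u ]) ≡ (π · x) [ to π a ≔ π · u ]
    atm-equivariant : ∀ π a → π · atm a ≡ atm (to π a)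
    atm-injective   : ∀ a b → atm a ≡ atm b → a ≡ b
    σ-var : ∀ a x → atm a [ a ≔ x ] ≡ x
    σ-id  : ∀ a x → x [ a ≔ atm a ] ≡ x
    σ-#   : ∀ a x u → a # x → x [ a ≔ u ] ≡ x
    σ-α   : ∀ a b x u → a ≢ b → b # x →
      x [ a ≔ u ] ≡ (swp b a · x) [ b ≔ u ]
    σ-σ   : ∀ a b x u v → a ≢ b → a # v →
      (x [ a ≔ u ]) [ b ≔ v ] ≡ (x [ b ≔ v ]) [ a ≔ u [ b ≔ v ] ]

record SigmaAlg (U : Termlike) : Set₁ where
  module U = Termlike U
  module UN = Nominal U.nom
  field
    nom : Nominal
  open Nominal nom
  field
    _[_≔_] : Carrier → Atom → UN.Carrier → Carrier
    sub-equivariant : ∀ π x a u →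
      π · (x [ a ≔ u ]) ≡ (π · x) [ to π a ≔ π UN.· u ]
    σ-id  : ∀ a x → x [ a ≔ U.atm a ] ≡ x
    σ-#   : ∀ a x u → a # x → x [ a ≔ u ] ≡ x
    σ-α   : ∀ a b x u → a ≢ b → b # x →
      x [ a ≔ u ] ≡ (swp b a · x) [ b ≔ u ]
    σ-σ   : ∀ a b x u v → a ≢ b → a UN.# v →
      (x [ a ≔ u ]) [ b ≔ v ] ≡ (x [ b ≔ v ]) [ a ≔ u U.[ b ≔ v ] ]

record NominalPoset (N : Nominal) : Set₁ where
  open Nominal N
  field
    _≤_            : Carrier → Carrier → Set
    isPartialOrder : IsPartialOrder _≡_ _≤_
    ≤-equivariant  : ∀ π x y → x ≤ y → (π · x) ≤ (π · y)

MonotoneSigma : {U : Termlike} (L : SigmaAlg U) → NominalPoset (SigmaAlg.nom L) → Set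
MonotoneSigma {U} L P = ∀ x y a u → x ≤ y → (x [ a ≔ u ]) ≤ (y [ a ≔ u ])
  where open SigmaAlg L
        open NominalPoset P

IsFreshLimit : {U : Termlike} (L : SigmaAlg U) → NominalPoset (SigmaAlg.nom L) →
               Atom → Nominal.Carrier (SigmaAlg.nom L) → Nominal.Carrier (SigmaAlg.nom L) → Set
IsFreshLimit L P a x l =
  (l ≤ x) × (a # l) × (∀ x' → x' ≤ x → a # x' → x' ≤ l)
  where open SigmaAlg L
        open Nominal nom
        open NominalPoset P

IsSubstGLB : {U : Termlike} (L : SigmaAlg U) → NominalPoset (SigmaAlg.nom L) →
             Atom → Nominal.Carrier (SigmaAlg.nom L) → Nominal.Carrier (SigmaAlg.nom L) → Set
IsSubstGLB {U} L P a x l =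
  (∀ (u : Nominal.Carrier (Termlike.nom U)) → l ≤ (x [ a ≔ u ])) ×
  (∀ l' → (∀ (u : Nominal.Carrier (Termlike.nom U)) → l' ≤ (x [ a ≔ u ])) → l' ≤ l)
  where open SigmaAlg L
        open NominalPoset P

-- Renaming a to an atom b fresh for x maps lower bounds of {x[a:=u] | u ∈ U} to
-- lower bounds, since (a b)·(x[a:=u]) = x[a:=(a b)·u]. For (1), a lower bound l'
-- thus yields (a b)·l' ≤ x[a:=a] = x with a # (a b)·l', so (a b)·l' ≤ ⋀^{#a}x,
-- and swapping back gives l' ≤ ⋀^{#a}x as a and b are fresh for the limit. For
-- (2), the glb l satisfies (a b)·l ≤ l, hence (a b)·l = l by antisymmetry, and
-- b # l gives a # (a b)·l = l.
module Submission where

open import Defs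
open import Function using (_∘_)
open import Data.Product using (∃; _×_; _,_; proj₁; proj₂)
open import Data.Nat using (suc) renaming (_≤_ to _≤ℕ_)
open import Data.Nat.Properties using (_≟_; m≤m+n; m≤n+m; ≤-trans; n≮n)
open import Data.Nat.ListAction using (sum)
open import Data.List using (List; []; _∷_; _++_; map)
open import Data.List.Membership.Propositional using (_∈_; _∉_)
open import Data.List.Membership.Propositional.Properties
  using (∈-map⁺; ∈-map⁻; ∈-++⁺ˡ; ∈-++⁺ʳ)
open import Data.List.Relation.Unary.Any using (here; there)
open import Relation.Nullary using (Dec; yes; no)
open import Relation.Nullary.Negation using (contradiction)
open import Relation.Binary.PropositionalEquality
  using (_≡_; _≢_; refl; sym; trans; cong; cong₂; subst; module ≡-Reasoning)
open import Relation.Binary.Structures using (IsPartialOrder)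

∈⇒≤sum : ∀ {n} xs → n ∈ xs → n ≤ℕ sum xs
∈⇒≤sum (x ∷ xs) (here refl) = m≤m+n x (sum xs)
∈⇒≤sum (x ∷ xs) (there n∈xs) = ≤-trans (∈⇒≤sum xs n∈xs) (m≤n+m (sum xs) x)

fresh-atom : (S : List Atom) → ∃ (_∉ S)
fresh-atom S = suc (sum S) , λ n∈S → n≮n (sum S) (∈⇒≤sum S n∈S)

swapA-left : ∀ a b → swapA a b a ≡ b
swapA-left a b with a ≟ a
... | yes _ = refl
... | no a≢a = contradiction refl a≢a

swapA-right : ∀ a b → swapA a b b ≡ a
swapA-right a b with b ≟ a
... | yes b≡a = b≡a
... | no _ with b ≟ b
...   | yes _ = refl
...   | no b≢b = contradiction refl b≢b

swapA-other : ∀ {a b n} → n ≢ a → n ≢ b → swapA a b n ≡ n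
swapA-other {a} {b} {n} n≢a n≢b with n ≟ a
... | yes n≡a = contradiction n≡a n≢a
... | no _ with n ≟ b
...   | yes n≡b = contradiction n≡b n≢b
...   | no _ = refl

swapA-comm : ∀ a b n → swapA a b n ≡ swapA b a n
swapA-comm a b n = by-cases (n ≟ a) (n ≟ b)
  where
  by-cases : Dec (n ≡ a) → Dec (n ≡ b) → swapA a b n ≡ swapA b a n
  by-cases (yes refl) _ = trans (swapA-left n b) (sym (swapA-right b n))
  by-cases (no _) (yes refl) = trans (swapA-right a n) (sym (swapA-left n a))
  by-cases (no n≢a) (no n≢b) = trans (swapA-other n≢a n≢b) (sym (swapA-other n≢b n≢a))

module NominalProperties (N : Nominal) where
  open Nominal N

  supp : Carrier → List Atom
  supp y = proj₁ (finSupp y)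

  ∉supp⇒# : ∀ {b} y → b ∉ supp y → b # y
  ∉supp⇒# y b∉ = supp y , proj₂ (finSupp y) , b∉

  fresh-atom-for : (S : List Atom) (y z : Carrier) → ∃ λ b → b ∉ S × b # y × b # z
  fresh-atom-for S y z =
    b , b∉ ∘ ∈-++⁺ˡ
      , ∉supp⇒# y (b∉ ∘ ∈-++⁺ʳ S ∘ ∈-++⁺ˡ)
      , ∉supp⇒# z (b∉ ∘ ∈-++⁺ʳ S ∘ ∈-++⁺ʳ (supp y))
    where
    b = proj₁ (fresh-atom (S ++ supp y ++ supp z))
    b∉ = proj₂ (fresh-atom (S ++ supp y ++ supp z))

  swp-involutive : ∀ a b y → swp a b · (swp a b · y) ≡ y
  swp-involutive a b y =
    trans (act-∘ _ _ y) (trans (act-ext _ idP (swapA-invol a b) y) (act-id y))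

  swp-comm : ∀ a b y → swp a b · y ≡ swp b a · y
  swp-comm a b = act-ext _ _ (swapA-comm a b)

  swp-supports : ∀ a b {S y} → Supports _·_ S y →
                 Supports _·_ (map (swapA a b) S) (swp a b · y)
  swp-supports a b {S} {y} S-supp τ τ-fixes = begin
    τ · (π · y)                  ≡⟨ swp-involutive a b _ ⟨
    π · (π · (τ · (π · y)))      ≡⟨ cong (λ z → π · (π · z)) (act-∘ τ π y) ⟩
    π · (π · ((τ ∘P π) · y))     ≡⟨ cong (π ·_) (act-∘ π (τ ∘P π) y) ⟩
    π · ((π ∘P (τ ∘P π)) · y)    ≡⟨ cong (π ·_) (S-supp (π ∘P (τ ∘P π)) conj-fixes) ⟩
    π · y                        ∎
    where
    open ≡-Reasoning
    π = swp a b
    conj-fixes : ∀ s → s ∈ S → swapA a b (to τ (swapA a b s)) ≡ s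
    conj-fixes s s∈S =
      trans (cong (swapA a b) (τ-fixes (swapA a b s) (∈-map⁺ (swapA a b) s∈S)))
            (swapA-invol a b s)

  swp-# : ∀ a b {y} → b # y → a # (swp a b · y)
  swp-# a b (S , S-supp , b∉S) = map (swapA a b) S , swp-supports a b S-supp , a∉
    where
    a∉ : a ∉ map (swapA a b) S
    a∉ a∈ with ∈-map⁻ (swapA a b) a∈
    ... | s , s∈S , a≡πs = b∉S (subst (_∈ S) s≡b s∈S)
      where
      s≡b : s ≡ b
      s≡b = trans (sym (swapA-invol a b s))
                  (trans (cong (swapA a b) (sym a≡πs)) (swapA-left a b))

  swp-fixes : ∀ {a b S y} → Supports _·_ S y → a ∉ S → b ∉ S → swp a b · y ≡ y
  swp-fixes {a} {b} {S} S-supp a∉S b∉S = S-supp (swp a b) λ s s∈S →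
    swapA-other (λ s≡a → a∉S (subst (_∈ S) s≡a s∈S))
                (λ s≡b → b∉S (subst (_∈ S) s≡b s∈S))

module NominalPosetProperties {N : Nominal} (P : NominalPoset N) where
  open Nominal N
  open NominalPoset P
  open IsPartialOrder isPartialOrder using (antisym)
  open NominalProperties N

  swp-transpose : ∀ a b {y z} → (swp a b · y) ≤ z → y ≤ (swp a b · z)
  swp-transpose a b {y} le =
    subst (_≤ _) (swp-involutive a b y) (≤-equivariant (swp a b) _ _ le)

  swp-≤⇒≡ : ∀ a b {y} → (swp a b · y) ≤ y → swp a b · y ≡ y
  swp-≤⇒≡ a b le = antisym le (swp-transpose a b le)

module SigmaAlgProperties {U : Termlike} (L : SigmaAlg U) where
  open SigmaAlg L
  open Nominal nom
  open NominalProperties nom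

  swp-subst : ∀ {a b} x u → a ≢ b → b # x →
              swp a b · (x [ a ≔ u ]) ≡ x [ a ≔ swp a b UN.· u ]
  swp-subst {a} {b} x u a≢b b#x = begin
    swp a b · (x [ a ≔ u ])
      ≡⟨ sub-equivariant (swp a b) x a u ⟩
    (swp a b · x) [ swapA a b a ≔ πu ]
      ≡⟨ cong₂ (λ y c → y [ c ≔ πu ]) (swp-comm a b x) (swapA-left a b) ⟩
    (swp b a · x) [ b ≔ πu ]
      ≡⟨ sym (σ-α a b x πu a≢b b#x) ⟩
    x [ a ≔ πu ] ∎
    where
    πu = swp a b UN.· u
    open ≡-Reasoning

module SubstLimits {U : Termlike} (L : SigmaAlg U) (P : NominalPoset (SigmaAlg.nom L))
                   (mono : MonotoneSigma L P) (x : Nominal.Carrier (SigmaAlg.nom L)) (a : Atom) where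
  open SigmaAlg L
  open Nominal nom
  open NominalPoset P
  open NominalProperties nom
  open NominalPosetProperties P
  open SigmaAlgProperties L
  module UP = NominalProperties U.nom

  SubstLowerBound : Carrier → Set
  SubstLowerBound l = ∀ u → l ≤ (x [ a ≔ u ])

  substLowerBound⇒≤ : ∀ {l} → SubstLowerBound l → l ≤ x
  substLowerBound⇒≤ lb = subst (_ ≤_) (σ-id a x) (lb (U.atm a))

  #-≤⇒substLowerBound : ∀ {y} → a # y → y ≤ x → SubstLowerBound y
  #-≤⇒substLowerBound {y} a#y y≤x u = subst (_≤ _) (σ-# a y u a#y) (mono y x a u y≤x)

  swp-substLowerBound : ∀ {b l} → b ≢ a → b # x → SubstLowerBound l →
                        SubstLowerBound (swp a b · l)
  swp-substLowerBound {b} {l} b≢a b#x lb u =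
    subst ((swp a b · l) ≤_) x[a≔u]
          (≤-equivariant (swp a b) _ _ (lb (swp a b UN.· u)))
    where
    x[a≔u] : swp a b · (x [ a ≔ swp a b UN.· u ]) ≡ x [ a ≔ u ]
    x[a≔u] = trans (swp-subst x _ (b≢a ∘ sym) b#x)
                   (cong (x [ a ≔_]) (UP.swp-involutive a b u))

  freshLimit⇒substGLB : ∀ l → IsFreshLimit L P a x l → IsSubstGLB L P a x l
  freshLimit⇒substGLB l (l≤x , a#l@(S , S-supp , a∉S) , greatest) =
    #-≤⇒substLowerBound a#l l≤x , below-l
    where
    below-l : ∀ l' → SubstLowerBound l' → l' ≤ l
    below-l l' lb =
      let (b , b∉ , b#x , b#l') = fresh-atom-for (a ∷ S) x l'
          πl'-lb = swp-substLowerBound (b∉ ∘ here) b#x lb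
          πl'≤l = greatest _ (substLowerBound⇒≤ πl'-lb) (swp-# a b b#l')
      in subst (l' ≤_) (swp-fixes S-supp a∉S (b∉ ∘ there)) (swp-transpose a b πl'≤l)

  substGLB⇒freshLimit : ∀ l → IsSubstGLB L P a x l → IsFreshLimit L P a x l
  substGLB⇒freshLimit l (lb , greatest) =
    substLowerBound⇒≤ lb , a#l ,
    λ x' x'≤x a#x' → greatest x' (#-≤⇒substLowerBound a#x' x'≤x)
    where
    a#l : a # l
    a#l =
      let (b , b∉ , b#x , b#l) = fresh-atom-for (a ∷ []) x l
          πl≤l = greatest _ (swp-substLowerBound (b∉ ∘ here) b#x lb)
      in subst (a #_) (swp-≤⇒≡ a b πl≤l) (swp-# a b b#l)

proposition4p15 : (U : Termlike) (L : SigmaAlg U) (P : NominalPoset (SigmaAlg.nom L))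
    → MonotoneSigma L P
    → (x : Nominal.Carrier (SigmaAlg.nom L)) (a : Atom)
    → (∀ l → IsFreshLimit L P a x l → IsSubstGLB L P a x l)
      × (∀ l → IsSubstGLB L P a x l → IsFreshLimit L P a x l)
proposition4p15 U L P mono x a = freshLimit⇒substGLB , substGLB⇒freshLimit
  where open SubstLimits L P mono x a
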